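{- Let $r$ be a nonnegative integer, let $G$ be a $(P_5+rK_1)$-free graph, and let $\mathcal{C}$ be a set of connected induced subgraphs of $G$. Then the graph $H(G,\mathcal{C})$ is also $(P_5+rK_1)$-free.
   Context: $P_5+rK_1$ is the disjoint union of the path on $5$ vertices and $r$ isolated vertices; a graph is $F$-free if it has no induced subgraph isomorphic to $F$. The graph $H(G,\mathcal{C})$ has vertex set $\{v_C: C\in\mathcal{C}\}$, and $v_Cv_{C'}$ (for distinct $C,C'\in\mathcal{C}$) is an edge if and only if $V(C)\cap V(C')\neq\emptyset$ or some vertex of $C$ is adjacent in $G$ to some vertex of $C'$. -}

module Defs where

open import Data.Nat using (ℕ; suc; _+_; _<_)
open import Data.Fin using (Fin; toℕ)
open import Data.Fin.Subset using (Subset; _∈_; Nonempty)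
open import Data.Product using (Σ; ∃; _×_; _,_)
open import Data.Sum using (_⊎_)
open import Relation.Nullary using (¬_; Dec)
open import Relation.Binary.PropositionalEquality using (_≡_)
open import Function.Definitions using (Injective)
open import Function.Bundles using (_⇔_)

record Graph (n : ℕ) : Set₁ where
  field
    Adj   : Fin n → Fin n → Set
    sym   : ∀ {u v} → Adj u v → Adj v u
    irrefl : ∀ {u} → ¬ Adj u u
    dec   : ∀ u v → Dec (Adj u v)
open Graph public

InducedCopy : ∀ {k n} → (Fin k → Fin k → Set) → (Fin n → Fin n → Set) → Set
InducedCopy {k} {n} AdjF R =
  Σ (Fin k → Fin n) λ f → Injective _≡_ _≡_ f × (∀ i j → R (f i) (f j) ⇔ AdjF i j)

Free : ∀ {k n} → (Fin k → Fin k → Set) → (Fin n → Fin n → Set) → Set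
Free AdjF R = ¬ InducedCopy AdjF R

-- P5 + r K1 on vertex set Fin (5 + r): vertices 0,1,2,3,4 form the path
-- 0-1-2-3-4, vertices 5,…,4+r are isolated.
P5+rK1 : (r : ℕ) → Fin (5 + r) → Fin (5 + r) → Set
P5+rK1 r i j = (toℕ j < 5 × toℕ j ≡ suc (toℕ i)) ⊎ (toℕ i < 5 × toℕ i ≡ suc (toℕ j))

data Reach {n} (G : Graph n) (S : Subset n) (u : Fin n) : Fin n → Set where
  here : u ∈ S → Reach G S u u
  step : ∀ {w v} → Reach G S u w → Adj G w v → v ∈ S → Reach G S u v

ConnectedIn : ∀ {n} → Graph n → Subset n → Set
ConnectedIn G S = Nonempty S × (∀ u v → u ∈ S → v ∈ S → Reach G S u v)

-- H(G, 𝒞) for a family 𝒞 : Fin m → Subset n (𝒞 i is the vertex set of the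
-- induced subgraph C_i): distinct i, j adjacent iff V(C_i) ∩ V(C_j) ≠ ∅ or
-- some vertex of C_i is adjacent in G to some vertex of C_j.
HAdj : ∀ {n m} → Graph n → (Fin m → Subset n) → Fin m → Fin m → Set
HAdj G 𝒞 i j =
  ¬ (i ≡ j) ×
  ((∃ λ v → v ∈ 𝒞 i × v ∈ 𝒞 j) ⊎
   (∃ λ u → ∃ λ v → u ∈ 𝒞 i × v ∈ 𝒞 j × Adj G u v))

{-# OPTIONS --safe #-}
-- Let A₀, …, A₄ be the members of 𝒞 on the P₅ of an induced P₅ + rK₁ in H(G, 𝒞). Members two
-- apart on the path neither meet nor are joined by an edge, so a walk in G[A₀ ∪ … ∪ A₄] that
-- starts in A₀ needs at least t steps to enter A_t (t ≥ 2). Since the Aₐ are connected and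
-- consecutive ones touch, A₄ is reached, so some vertex has distance exactly 4 from A₀; a
-- shortest path to it runs through consecutive distance layers and is therefore an induced P₅.
-- A vertex of each member on an isolated vertex of the copy is distinct from, and nonadjacent
-- to, all other chosen vertices, which completes an induced P₅ + rK₁ in G.
module Submission where

open import Defs
open import Level using (0ℓ)
open import Data.Nat
  using (ℕ; zero; suc; _+_; _∸_; _≤_; _<_; _≤′_; z≤n; s≤s; ≤′-refl; ≤′-step; _<?_)
  renaming (_≟_ to _≟ℕ_)
open import Data.Nat.Properties
  using (≤-trans; ≤-antisym; ≤-reflexive; ≤-pred; ≤⇒≤′; ≮⇒≥; <⇒≱; <-cmp; n≤1+n;
         m+n≮m; m∸[m∸n]≡n; +-∸-assoc; suc-injective)
open import Data.Fin using (Fin; zero; suc; toℕ; inject₁; opposite; _↑ˡ_; _↑ʳ_; _≟_)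
open import Data.Fin.Properties
  using (toℕ-injective; ↑ˡ-injective; toℕ-inject₁; toℕ-fromℕ; toℕ-↑ˡ; toℕ-↑ʳ; toℕ<n;
         toℕ≤pred[n]; opposite-prop; any?)
import Data.Fin.Properties as Fin
open import Data.Fin.Induction using (<-weakInduction)
open import Data.Fin.Subset using (Subset; _∈_)
open import Data.Fin.Subset.Properties using (_∈?_)
open import Data.Product using (Σ-syntax; ∃; _×_; _,_; proj₁; proj₂)
open import Data.Sum using (_⊎_; inj₁; inj₂; swap) renaming (map to ⊎-map)
open import Data.Empty using (⊥-elim)
open import Function using (_∘_)
open import Function.Bundles using (_⇔_; mk⇔; Equivalence)
open import Function.Definitions using (Injective)
open import Relation.Binary using (tri<; tri≈; tri>)
open import Relation.Binary.PropositionalEquality as ≡ using (_≡_; _≢_; refl; cong; subst)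
open import Relation.Nullary using (¬_; Dec; yes; no)
open import Relation.Nullary.Decidable using (_⊎-dec_; _×-dec_)
open import Relation.Unary using (Pred; Decidable; _⊆_)

open Equivalence using (to; from)

m≤1+n∧n≤1+m∧m≢n⇒n≡1+m⊎m≡1+n : ∀ {m n} → m ≤ suc n → n ≤ suc m → m ≢ n →
                                n ≡ suc m ⊎ m ≡ suc n
m≤1+n∧n≤1+m∧m≢n⇒n≡1+m⊎m≡1+n {m} {n} m≤1+n n≤1+m m≢n with <-cmp m n
... | tri< m<n _ _ = inj₁ (≤-antisym n≤1+m m<n)
... | tri≈ _ m≡n _ = ⊥-elim (m≢n m≡n)
... | tri> _ _ n<m = inj₂ (≤-antisym m≤1+n n<m)

↑ˡ≢↑ʳ : ∀ {m n} (a : Fin m) (l : Fin n) → a ↑ˡ n ≢ m ↑ʳ l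
↑ˡ≢↑ʳ zero    l ()
↑ˡ≢↑ʳ (suc a) l e = ↑ˡ≢↑ʳ a l (Fin.suc-injective e)

data Split (m n : ℕ) : Fin (m + n) → Set where
  left  : (a : Fin m) → Split m n (a ↑ˡ n)
  right : (l : Fin n) → Split m n (m ↑ʳ l)

split : ∀ m {n} (i : Fin (m + n)) → Split m n i
split zero    i       = right i
split (suc m) zero    = left zero
split (suc m) (suc i) with split m i
... | left a  = left (suc a)
... | right l = right l

PathAdj : ∀ {k} → Fin k → Fin k → Set
PathAdj a b = toℕ b ≡ suc (toℕ a) ⊎ toℕ a ≡ suc (toℕ b)

PathAdj-inject₁-suc : ∀ {k} (a : Fin k) → PathAdj (inject₁ a) (suc a)
PathAdj-inject₁-suc a = inj₁ (cong suc (≡.sym (toℕ-inject₁ a)))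

≡⊎PathAdj⇒≤1+ : ∀ {k} {a b : Fin k} → a ≡ b ⊎ PathAdj a b → toℕ b ≤ suc (toℕ a)
≡⊎PathAdj⇒≤1+ {a = a} (inj₁ refl)        = n≤1+n (toℕ a)
≡⊎PathAdj⇒≤1+         (inj₂ (inj₁ b≡1+a)) = ≤-reflexive b≡1+a
≡⊎PathAdj⇒≤1+ {a = a} {b} (inj₂ (inj₂ a≡1+b)) =
  ≤-trans (n≤1+n (toℕ b)) (≤-trans (≤-reflexive (≡.sym a≡1+b)) (n≤1+n (toℕ a)))

Touching : ∀ {n} → Graph n → Subset n → Subset n → Set
Touching G S T =
  (∃ λ v → v ∈ S × v ∈ T) ⊎ (∃ λ u → ∃ λ v → u ∈ S × v ∈ T × Adj G u v)

Apart : ∀ {n} → Graph n → Fin n → Fin n → Set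
Apart G u v = u ≢ v × ¬ Adj G u v

apart-sym : ∀ {n} (G : Graph n) {u v} → Apart G u v → Apart G v u
apart-sym G (u≢v , ¬adj) = u≢v ∘ ≡.sym , ¬adj ∘ sym G

¬touching⇒apart : ∀ {n} (G : Graph n) {S T u v} →
                  ¬ Touching G S T → u ∈ S → v ∈ T → Apart G u v
¬touching⇒apart G ¬touch u∈S v∈T =
  (λ { refl → ¬touch (inj₁ (_ , u∈S , v∈T)) }) ,
  (λ adj → ¬touch (inj₂ (_ , _ , u∈S , v∈T , adj)))

module _ {k n} {F : Fin k → Fin k → Set} (G : Graph n) where

  inducedCopy⇒apart : ((g , _) : InducedCopy F (Adj G)) → ∀ {i j} →
                      i ≢ j → ¬ F i j → Apart G (g i) (g j)
  inducedCopy⇒apart (g , g-injective , g-iso) i≢j ¬p = i≢j ∘ g-injective , ¬p ∘ to (g-iso _ _)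

  mkInducedCopy : (∀ i j → Dec (F i j)) → (g : Fin k → Fin n) →
                  (∀ {i j} → F i j → Adj G (g i) (g j)) →
                  (∀ {i j} → i ≢ j → ¬ F i j → Apart G (g i) (g j)) →
                  InducedCopy F (Adj G)
  mkInducedCopy F? g edge apart = g , injective , λ i j → mk⇔ (reflect i j) edge
    where
    injective : Injective _≡_ _≡_ g
    injective {i} {j} gi≡gj with i ≟ j | F? i j
    ... | yes i≡j | _      = i≡j
    ... | no i≢j  | yes p  = ⊥-elim (irrefl G (subst (Adj G (g i)) (≡.sym gi≡gj) (edge p)))
    ... | no i≢j  | no ¬p  = ⊥-elim (proj₁ (apart i≢j ¬p) gi≡gj)
    reflect : ∀ i j → Adj G (g i) (g j) → F i j
    reflect i j adj with F? i j | i ≟ j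
    ... | yes p | _       = p
    ... | no ¬p | yes refl = ⊥-elim (irrefl G adj)
    ... | no ¬p | no i≢j  = ⊥-elim (proj₂ (apart i≢j ¬p) adj)

module Layers {n} (G : Graph n) {U S : Pred (Fin n) 0ℓ}
              (U? : Decidable U) (S? : Decidable S) (S⊆U : S ⊆ U) where

  Ball : ℕ → Pred (Fin n) 0ℓ
  Ball zero    = S
  Ball (suc t) v = Ball t v ⊎ (U v × ∃ λ u → Ball t u × Adj G u v)

  Sphere : ℕ → Pred (Fin n) 0ℓ
  Sphere zero    = S
  Sphere (suc t) v = Ball (suc t) v × ¬ Ball t v

  ball? : ∀ t → Decidable (Ball t)
  ball? zero    = S?
  ball? (suc t) v = ball? t v ⊎-dec (U? v ×-dec any? λ u → ball? t u ×-dec dec G u v)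

  ball⊆U : ∀ {t} → Ball t ⊆ U
  ball⊆U {zero}  = S⊆U
  ball⊆U {suc t} (inj₁ b)        = ball⊆U b
  ball⊆U {suc t} (inj₂ (Uv , _)) = Uv

  ball-mono : ∀ {s t} → s ≤ t → Ball s ⊆ Ball t
  ball-mono = mono′ ∘ ≤⇒≤′
    where
    mono′ : ∀ {s t} → s ≤′ t → Ball s ⊆ Ball t
    mono′ ≤′-refl      b = b
    mono′ (≤′-step s≤t) b = inj₁ (mono′ s≤t b)

  sphere⊆ball : ∀ {t} → Sphere t ⊆ Ball t
  sphere⊆ball {zero}  v∈S    = v∈S
  sphere⊆ball {suc t} (b , _) = b

  sphere-≤ : ∀ {s t v} → Sphere t v → Ball s v → t ≤ s
  sphere-≤ {t = zero}  _        _ = z≤n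
  sphere-≤ {t = suc t} (_ , ∉t) b = ≮⇒≥ λ s<1+t → ∉t (ball-mono (≤-pred s<1+t) b)

  sphere-unique : ∀ {s t v} → Sphere s v → Sphere t v → s ≡ t
  sphere-unique ss st = ≤-antisym (sphere-≤ ss (sphere⊆ball st)) (sphere-≤ st (sphere⊆ball ss))

  sphere-adj : ∀ {s t u v} → Sphere s u → Sphere t v → Adj G u v → t ≤ suc s
  sphere-adj su sv adj = sphere-≤ sv (inj₂ (ball⊆U (sphere⊆ball sv) , _ , sphere⊆ball su , adj))

  sphere-pred : ∀ {t v} → Sphere (suc t) v → ∃ λ u → Sphere t u × Adj G u v
  sphere-pred         (inj₁ b , ∉t)                 = ⊥-elim (∉t b)
  sphere-pred {zero}  (inj₂ (_ , u , u∈S , adj) , _) = u , u∈S , adj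
  sphere-pred {suc t} (inj₂ (Uv , u , b , adj) , ∉t) =
    u , (b , λ b′ → ∉t (inj₂ (Uv , u , b′ , adj))) , adj

  ball∖ball⇒sphere : ∀ {j K w} → Ball K w → ¬ Ball j w → ∃ (Sphere (suc j))
  ball∖ball⇒sphere {K = zero} b ∉j = ⊥-elim (∉j (ball-mono z≤n b))
  ball∖ball⇒sphere {j} {suc K} {w} b ∉j with ball? (suc j) w
  ... | yes b′ = w , b′ , ∉j
  ... | no ∉j+1 with b
  ...   | inj₁ b″                = ball∖ball⇒sphere b″ ∉j
  ...   | inj₂ (Uw , u , bu , adj) =
    ball∖ball⇒sphere bu (λ bju → ∉j+1 (inj₂ (Uw , u , bju , adj)))

  descent : ∀ k {v} → Sphere k v → Fin (suc k) → Fin n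
  descent k       {v} _ zero    = v
  descent (suc k)     s (suc a) = descent k (proj₁ (proj₂ (sphere-pred s))) a

  descent-layer : ∀ k {v} (s : Sphere k v) a → Sphere (k ∸ toℕ a) (descent k s a)
  descent-layer k       s zero    = s
  descent-layer (suc k) s (suc a) = descent-layer k _ a

  descent-adj : ∀ k {v} (s : Sphere k v) a b → toℕ b ≡ suc (toℕ a) →
                Adj G (descent k s b) (descent k s a)
  descent-adj (suc k) s zero    (suc zero) _ = proj₂ (proj₂ (sphere-pred s))
  descent-adj (suc k) s (suc a) (suc b)    e = descent-adj k _ a b (suc-injective e)

  geodesic : ∀ {k v} → Sphere k v → Fin (suc k) → Fin n
  geodesic {k} s = descent k s ∘ opposite

  geodesic-layer : ∀ {k v} (s : Sphere k v) a → Sphere (toℕ a) (geodesic s a)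
  geodesic-layer {k} s a =
    subst (λ t → Sphere t (geodesic s a)) layer (descent-layer k s (opposite a))
    where
    open ≡.≡-Reasoning
    layer : k ∸ toℕ (opposite a) ≡ toℕ a
    layer = begin
      k ∸ toℕ (opposite a) ≡⟨ cong (k ∸_) (opposite-prop a) ⟩
      k ∸ (k ∸ toℕ a)      ≡⟨ m∸[m∸n]≡n (toℕ≤pred[n] a) ⟩
      toℕ a                ∎

  geodesic-adj : ∀ {k v} (s : Sphere k v) {a b} → toℕ b ≡ suc (toℕ a) →
                 Adj G (geodesic s a) (geodesic s b)
  geodesic-adj {k} s {a} {b} b≡1+a = descent-adj k s (opposite b) (opposite a) layers
    where
    open ≡.≡-Reasoning
    layers : toℕ (opposite a) ≡ suc (toℕ (opposite b))
    layers = begin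
      toℕ (opposite a)       ≡⟨ opposite-prop a ⟩
      k ∸ toℕ a              ≡⟨ +-∸-assoc 1 (subst (_≤ k) b≡1+a (toℕ≤pred[n] b)) ⟩
      suc (k ∸ suc (toℕ a))  ≡⟨ cong (λ x → suc (k ∸ x)) (≡.sym b≡1+a) ⟩
      suc (k ∸ toℕ b)        ≡⟨ cong suc (≡.sym (opposite-prop b)) ⟩
      suc (toℕ (opposite b)) ∎

  sphere⇒inducedPath : ∀ {k v} → Sphere k v →
                       Σ[ (y , _) ∈ InducedCopy (PathAdj {suc k}) (Adj G) ] (∀ a → U (y a))
  sphere⇒inducedPath s =
    (y , injective , λ a b → mk⇔ (adj⇒path a b) (path⇒adj a b)) ,
    λ a → ball⊆U (sphere⊆ball (layer a))
    where
    y : Fin _ → Fin n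
    y = geodesic s
    layer : ∀ a → Sphere (toℕ a) (y a)
    layer = geodesic-layer s
    injective : Injective _≡_ _≡_ y
    injective {a} {b} ya≡yb =
      toℕ-injective (sphere-unique (layer a) (subst (Sphere (toℕ b)) (≡.sym ya≡yb) (layer b)))
    adj⇒path : ∀ a b → Adj G (y a) (y b) → PathAdj a b
    adj⇒path a b adj = m≤1+n∧n≤1+m∧m≢n⇒n≡1+m⊎m≡1+n
      (sphere-adj (layer b) (layer a) (sym G adj))
      (sphere-adj (layer a) (layer b) adj)
      (λ a≡b → irrefl G (subst (λ c → Adj G (y a) (y c)) (≡.sym (toℕ-injective a≡b)) adj))
    path⇒adj : ∀ a b → PathAdj a b → Adj G (y a) (y b)
    path⇒adj a b (inj₁ b≡1+a) = geodesic-adj s b≡1+a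
    path⇒adj a b (inj₂ a≡1+b) = sym G (geodesic-adj s a≡1+b)

module Chain {n k} (G : Graph n) (A : Fin (suc k) → Subset n)
  (connected : ∀ a → ConnectedIn G (A a))
  (linked : ∀ (a : Fin k) → Touching G (A (inject₁ a)) (A (suc a)))
  (far : ∀ a b → suc (toℕ a) < toℕ b → ¬ Touching G (A a) (A b)) where

  InChain : Pred (Fin n) 0ℓ
  InChain v = ∃ λ b → v ∈ A b

  open Layers G {InChain} {_∈ A zero} (λ v → any? λ b → v ∈? A b) (_∈? A zero) (zero ,_) public

  touching-index : ∀ {b c} → Touching G (A c) (A b) → toℕ b ≤ suc (toℕ c)
  touching-index {b} {c} touch = ≮⇒≥ λ c+1<b → far c b c+1<b touch

  ball-index : ∀ {t v} → Ball t v → ∃ λ c → toℕ c ≤ t × v ∈ A c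
  ball-suc-index : ∀ {t v b} → Ball (suc t) v → v ∈ A b → toℕ b ≤ suc t

  ball-index {zero}  v∈A₀ = zero , z≤n , v∈A₀
  ball-index {suc t} bv   = let c , v∈c = ball⊆U {suc t} bv in c , ball-suc-index bv v∈c , v∈c

  ball-suc-index (inj₁ bv) v∈b =
    let c , c≤t , v∈c = ball-index bv
    in ≤-trans (touching-index (inj₁ (_ , v∈c , v∈b))) (s≤s c≤t)
  ball-suc-index (inj₂ (_ , u , bu , adj)) v∈b =
    let c , c≤t , u∈c = ball-index bu
    in ≤-trans (touching-index (inj₂ (u , _ , u∈c , v∈b , adj))) (s≤s c≤t)

  Reached : Pred (Fin n) 0ℓ
  Reached v = ∃ λ t → Ball t v

  reached-step : ∀ {u v} → Reached u → Adj G u v → InChain v → Reached v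
  reached-step (t , bu) adj v∈⋃ = suc t , inj₂ (v∈⋃ , _ , bu , adj)

  reached-within : ∀ {a u v} → Reached u → Reach G (A a) u v → Reached v
  reached-within ru (here _)         = ru
  reached-within ru (step p adj v∈a) = reached-step (reached-within ru p) adj (_ , v∈a)

  all-reached : ∀ a {v} → v ∈ A a → Reached v
  all-reached = <-weakInduction (λ a → ∀ {v} → v ∈ A a → Reached v) (0 ,_) next
    where
    next : ∀ a → (∀ {v} → v ∈ A (inject₁ a) → Reached v) → ∀ {v} → v ∈ A (suc a) → Reached v
    next a reached v∈a+1 =
      let w , w∈a+1 , rw = entry (linked a)
      in reached-within rw (proj₂ (connected (suc a)) w _ w∈a+1 v∈a+1)
      where
      entry : Touching G (A (inject₁ a)) (A (suc a)) → ∃ λ w → w ∈ A (suc a) × Reached w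
      entry (inj₁ (w , w∈a , w∈a+1))           = w , w∈a+1 , reached w∈a
      entry (inj₂ (u , w , u∈a , w∈a+1 , adj)) =
        w , w∈a+1 , reached-step (reached u∈a) adj (_ , w∈a+1)

  sphere-inhabited : ∀ {b t} → toℕ b ≡ suc (suc t) → ∃ (Sphere (suc (suc t)))
  sphere-inhabited {b} {t} b≡2+t =
    let w , w∈b = proj₁ (connected b)
        K , bw  = all-reached b w∈b
    in ball∖ball⇒sphere {j = suc t} {K} bw
         λ bw′ → <⇒≱ (≤-reflexive (≡.sym b≡2+t)) (ball-suc-index bw′ w∈b)

chain⇒inducedPath : ∀ {n k} (G : Graph n) (A : Fin (suc k) → Subset n) → 2 ≤ k →
                    (∀ a → ConnectedIn G (A a)) →
                    (∀ (a : Fin k) → Touching G (A (inject₁ a)) (A (suc a))) →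
                    (∀ a b → suc (toℕ a) < toℕ b → ¬ Touching G (A a) (A b)) →
                    Σ[ (y , _) ∈ InducedCopy (PathAdj {suc k}) (Adj G) ] (∀ a → ∃ λ b → y a ∈ A b)
chain⇒inducedPath {k = suc (suc t)} G A (s≤s (s≤s _)) connected linked far =
  sphere⇒inducedPath {k = suc (suc t)} (proj₂ (sphere-inhabited (toℕ-fromℕ (suc (suc t)))))
  where open Chain G A connected linked far

P5+rK1-dec : ∀ r i j → Dec (P5+rK1 r i j)
P5+rK1-dec r i j =
  (toℕ j <? 5 ×-dec toℕ j ≟ℕ suc (toℕ i)) ⊎-dec (toℕ i <? 5 ×-dec toℕ i ≟ℕ suc (toℕ j))

P5+rK1-sym : ∀ {r i j} → P5+rK1 r i j → P5+rK1 r j i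
P5+rK1-sym = swap

P5+rK1⇒<5 : ∀ {r i j} → P5+rK1 r i j → toℕ j < 5
P5+rK1⇒<5 (inj₁ (j<5 , _))      = j<5
P5+rK1⇒<5 (inj₂ (i<5 , i≡1+j)) = ≤-trans (n≤1+n _) (subst (_< 5) i≡1+j i<5)

¬P5+rK1-isolated : ∀ {r i} (l : Fin r) → ¬ P5+rK1 r i (5 ↑ʳ l)
¬P5+rK1-isolated l p = m+n≮m 5 (toℕ l) (subst (_< 5) (toℕ-↑ʳ 5 l) (P5+rK1⇒<5 p))

P5+rK1-↑ˡ : ∀ {r} (a b : Fin 5) → P5+rK1 r (a ↑ˡ r) (b ↑ˡ r) ⇔ PathAdj a b
P5+rK1-↑ˡ {r} a b rewrite toℕ-↑ˡ a r | toℕ-↑ˡ b r =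
  mk⇔ (⊎-map proj₂ proj₂) (⊎-map (toℕ<n b ,_) (toℕ<n a ,_))

module _ {k n m} {F : Fin k → Fin k → Set} (G : Graph n) (𝒞 : Fin m → Subset n) where

  HAdj-copy⇒touching : ((f , _) : InducedCopy F (HAdj G 𝒞)) → ∀ {i j} →
                       F i j → Touching G (𝒞 (f i)) (𝒞 (f j))
  HAdj-copy⇒touching (f , _ , f-iso) p = proj₂ (from (f-iso _ _) p)

  HAdj-copy⇒¬touching : ((f , _) : InducedCopy F (HAdj G 𝒞)) → ∀ {i j} → i ≢ j → ¬ F i j →
                        ¬ Touching G (𝒞 (f i)) (𝒞 (f j))
  HAdj-copy⇒¬touching (f , f-injective , f-iso) i≢j ¬p touch =
    ¬p (to (f-iso _ _) (i≢j ∘ f-injective , touch))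

module Transfer {r n m} (G : Graph n) (𝒞 : Fin m → Subset n)
                (connected : ∀ i → ConnectedIn G (𝒞 i))
                (copy : InducedCopy (P5+rK1 r) (HAdj G 𝒞)) where

  A : Fin 5 → Subset n
  A a = 𝒞 (proj₁ copy (a ↑ˡ r))

  path : Σ[ (y , _) ∈ InducedCopy (PathAdj {5}) (Adj G) ] (∀ a → ∃ λ b → y a ∈ A b)
  path = chain⇒inducedPath G A (s≤s (s≤s z≤n)) (λ _ → connected _) linked far
    where
    linked : ∀ (a : Fin 4) → Touching G (A (inject₁ a)) (A (suc a))
    linked a = HAdj-copy⇒touching G 𝒞 copy (from (P5+rK1-↑ˡ _ _) (PathAdj-inject₁-suc a))
    far : ∀ a b → suc (toℕ a) < toℕ b → ¬ Touching G (A a) (A b)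
    far a b a+1<b = HAdj-copy⇒¬touching G 𝒞 copy
      (¬near ∘ inj₁ ∘ ↑ˡ-injective r a b) (¬near ∘ inj₂ ∘ to (P5+rK1-↑ˡ a b))
      where
      ¬near : ¬ (a ≡ b ⊎ PathAdj a b)
      ¬near = <⇒≱ a+1<b ∘ ≡⊎PathAdj⇒≤1+

  y : Fin 5 → Fin n
  y = proj₁ (proj₁ path)

  isolated : Fin r → Fin n
  isolated l = proj₁ (proj₁ (connected (proj₁ copy (5 ↑ʳ l))))

  isolated∈ : ∀ l → isolated l ∈ 𝒞 (proj₁ copy (5 ↑ʳ l))
  isolated∈ l = proj₂ (proj₁ (connected (proj₁ copy (5 ↑ʳ l))))

  path-isolated-apart : ∀ a l → Apart G (y a) (isolated l)
  path-isolated-apart a l =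
    let b , ya∈b = proj₂ path a
        apart = HAdj-copy⇒¬touching G 𝒞 copy (↑ˡ≢↑ʳ b l) (¬P5+rK1-isolated l)
    in ¬touching⇒apart G apart ya∈b (isolated∈ l)

  vertex : Fin (5 + r) → Fin n
  vertex i with split 5 i
  ... | left a  = y a
  ... | right l = isolated l

  vertex-edge : ∀ {i j} → P5+rK1 r i j → Adj G (vertex i) (vertex j)
  vertex-edge {i} {j} p with split 5 i | split 5 j
  ... | left a  | left b  = from (proj₂ (proj₂ (proj₁ path)) a b) (to (P5+rK1-↑ˡ a b) p)
  ... | left a  | right l = ⊥-elim (¬P5+rK1-isolated l p)
  ... | right l | _       = ⊥-elim (¬P5+rK1-isolated l (P5+rK1-sym p))

  vertex-apart : ∀ {i j} → i ≢ j → ¬ P5+rK1 r i j → Apart G (vertex i) (vertex j)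
  vertex-apart {i} {j} i≢j ¬p with split 5 i | split 5 j
  ... | left a  | left b   =
    inducedCopy⇒apart G (proj₁ path) (i≢j ∘ cong (_↑ˡ r)) (¬p ∘ from (P5+rK1-↑ˡ a b))
  ... | left a  | right l  = path-isolated-apart a l
  ... | right l | left a   = apart-sym G (path-isolated-apart a l)
  ... | right l | right l′ =
    ¬touching⇒apart G (HAdj-copy⇒¬touching G 𝒞 copy i≢j ¬p) (isolated∈ l) (isolated∈ l′)

  inducedCopy : InducedCopy (P5+rK1 r) (Adj G)
  inducedCopy = mkInducedCopy G (P5+rK1-dec r) vertex vertex-edge vertex-apart

-- The members of 𝒞 need not be distinct: the copy in H(G, 𝒞) is injective already.
lemma2p4 : (r n m : ℕ) (G : Graph n) → Free (P5+rK1 r) (Adj G) →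
           (𝒞 : Fin m → Subset n) → Injective _≡_ _≡_ 𝒞 →
           (∀ i → ConnectedIn G (𝒞 i)) →
           Free (P5+rK1 r) (HAdj G 𝒞)
lemma2p4 r n m G G-free 𝒞 _ connected copy = G-free (Transfer.inducedCopy G 𝒞 connected copy)
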